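{- Let $K$ be a $\mathfrak{g}$-field. Then $[K:K^{\mathfrak{g}}]\leqslant e$.
   Context: Let $\mathbf{k}$ be a field and $\mathfrak{g}=\mathrm{Spec}(H)$ a finite group scheme over $\mathbf{k}$, with $H$ a finite-dimensional commutative Hopf algebra (comultiplication $\mu$, counit $\pi$), and $e=\dim_{\mathbf{k}}H$ (the order of $\mathfrak{g}$). A $\mathfrak{g}$-field is a field $K\supseteq\mathbf{k}$ with a $\mathbf{k}$-algebra map $\partial:K\to K\otimes_{\mathbf{k}}H$ satisfying $(\mathrm{id}\otimes\pi)\circ\partial=\mathrm{id}$ and $(\mathrm{id}\otimes\mu)\circ\partial=(\partial\otimes\mathrm{id})\circ\partial$ (an action of $\mathfrak{g}$ on $\mathrm{Spec}(K)$). The field of constants is $K^{\mathfrak{g}}=\{x\in K:\partial(x)=x\otimes 1\}$. -}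

module Defs where

open import Level using (Level; _⊔_) renaming (suc to lsuc)
open import Algebra.Bundles using (CommutativeRing)
open import Algebra.Morphism.Structures using (module RingMorphisms)
open import Data.Nat.Base using (ℕ; _≤_)
open import Data.Fin.Base using (Fin)
open import Data.Fin.Properties using (_≟_)
open import Data.Product.Base using (∃-syntax)
open import Relation.Nullary using (¬_; does)
open import Data.Bool.Base using (if_then_else_)
import Algebra.Properties.Monoid.Sum as MonoidSum

private variable c ℓ c' ℓ' : Level

record IsField (R : CommutativeRing c ℓ) : Set (c ⊔ ℓ) where
  open CommutativeRing R
  field
    1≉0     : ¬ (1# ≈ 0#)
    inverse : ∀ x → ¬ (x ≈ 0#) → ∃[ y ] (x * y ≈ 1#)

record Field (c ℓ : Level) : Set (lsuc (c ⊔ ℓ)) where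
  field
    commutativeRing : CommutativeRing c ℓ
    isField         : IsField commutativeRing
  open CommutativeRing commutativeRing public
  open IsField isField public

∑ : (F : Field c ℓ) → ∀ {n} → (Fin n → Field.Carrier F) → Field.Carrier F
∑ F = MonoidSum.sum (Field.+-monoid F)

δ : (F : Field c ℓ) → ∀ {n} → Fin n → Fin n → Field.Carrier F
δ F i j = if does (i ≟ j) then Field.1# F else Field.0# F

-- A finite-dimensional commutative Hopf algebra H over the field k,
-- of dimension e, given by its structure constants with respect to a
-- k-basis b₀ … b_{e-1} of H:
--   b_i b_j   = ∑_l  m i j l · b_l                 (multiplication)
--   1_H       = ∑_l  u l · b_l                     (unit)
--   μ(b_j)    = ∑_{p,q} Δ j p q · b_p ⊗ b_q        (comultiplication)
--   π(b_j)    = ε j                                 (counit)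
--   S(b_j)    = ∑_l  S j l · b_l                   (antipode)

record FiniteHopfAlgebra (k : Field c ℓ) (e : ℕ) : Set (c ⊔ ℓ) where
  open Field k
  field
    m : Fin e → Fin e → Fin e → Carrier
    u : Fin e → Carrier
    Δ : Fin e → Fin e → Fin e → Carrier
    ε : Fin e → Carrier
    S : Fin e → Fin e → Carrier
    m-comm  : ∀ i j l → m i j l ≈ m j i l
    m-assoc : ∀ i j k' l →
      ∑ k (λ p → m i j p * m p k' l) ≈ ∑ k (λ p → m j k' p * m i p l)
    m-unit  : ∀ j l → ∑ k (λ p → u p * m p j l) ≈ δ k j l
    Δ-coassoc : ∀ j a b c'' →
      ∑ k (λ p → Δ j p c'' * Δ p a b) ≈ ∑ k (λ q → Δ j a q * Δ q b c'')
    ε-counitˡ : ∀ j l → ∑ k (λ p → ε p * Δ j p l) ≈ δ k j l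
    ε-counitʳ : ∀ j l → ∑ k (λ q → Δ j l q * ε q) ≈ δ k j l
    Δ-mult : ∀ i j a b →
      ∑ k (λ p → m i j p * Δ p a b)
        ≈ ∑ k (λ a₁ → ∑ k (λ b₁ → ∑ k (λ a₂ → ∑ k (λ b₂ →
             Δ i a₁ b₁ * Δ j a₂ b₂ * m a₁ a₂ a * m b₁ b₂ b))))
    Δ-unit : ∀ a b → ∑ k (λ p → u p * Δ p a b) ≈ u a * u b
    ε-mult : ∀ i j → ∑ k (λ p → m i j p * ε p) ≈ ε i * ε j
    ε-unit : ∑ k (λ p → u p * ε p) ≈ 1#
    S-antipodeˡ : ∀ j l →
      ∑ k (λ p → ∑ k (λ q → ∑ k (λ r → Δ j p q * S p r * m r q l))) ≈ ε j * u l
    S-antipodeʳ : ∀ j l →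
      ∑ k (λ p → ∑ k (λ q → ∑ k (λ r → Δ j p q * S q r * m p r l))) ≈ ε j * u l

-- A 𝔤-field for 𝔤 = Spec H: a field extension K ⊇ k (via the ring map
-- ι : k → K) together with a k-algebra map ∂ : K → K ⊗_k H, where
-- K ⊗_k H is identified with K^e via the basis (b_j):
--   ∂(x) = ∑_j ∂ x j ⊗ b_j.

record GField (k : Field c ℓ) {e : ℕ} (H : FiniteHopfAlgebra k e)
              (c' ℓ' : Level) : Set (c ⊔ ℓ ⊔ lsuc (c' ⊔ ℓ')) where
  module k = Field k
  module H = FiniteHopfAlgebra H
  field
    K : Field c' ℓ'
  open Field K
  open RingMorphisms k.rawRing rawRing
  field
    ι     : k.Carrier → Carrier
    ι-hom : IsRingHomomorphism ι
    ∂     : Carrier → Fin e → Carrier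
    ∂-cong : ∀ {x y} → x ≈ y → ∀ j → ∂ x j ≈ ∂ y j
    ∂-+    : ∀ x y j → ∂ (x + y) j ≈ ∂ x j + ∂ y j
    ∂-*    : ∀ x y l →
      ∂ (x * y) l ≈ ∑ K (λ i → ∑ K (λ j → ∂ x i * ∂ y j * ι (H.m i j l)))
    ∂-1    : ∀ l → ∂ 1# l ≈ ι (H.u l)
    ∂-k    : ∀ a l → ∂ (ι a) l ≈ ι a * ι (H.u l)
    ∂-counit : ∀ x → ∑ K (λ j → ∂ x j * ι (H.ε j)) ≈ x
    -- (id ⊗ μ) ∘ ∂ = (∂ ⊗ id) ∘ ∂   (coefficient of b_l ⊗ b_q)
    ∂-coassoc : ∀ x l q → ∂ (∂ x q) l ≈ ∑ K (λ j → ∂ x j * ι (H.Δ j l q))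

  -- K^𝔤 : x is a constant iff ∂(x) = x ⊗ 1 = ∑_j (u j · x) ⊗ b_j
  IsConstant : Carrier → Set ℓ'
  IsConstant x = ∀ j → ∂ x j ≈ ι (H.u j) * x

  LinearlyIndependentOverConstants : ∀ {n} → (Fin n → Carrier) → Set (c' ⊔ ℓ')
  LinearlyIndependentOverConstants {n} v =
    (a : Fin n → Carrier) → (∀ i → IsConstant (a i)) →
    ∑ K (λ i → a i * v i) ≈ 0# → ∀ i → a i ≈ 0#

  DegreeOverConstants≤ : ℕ → Set (c' ⊔ ℓ')
  DegreeOverConstants≤ d =
    ∀ n (v : Fin n → Carrier) → LinearlyIndependentOverConstants v → n ≤ d

module Submission where

-- Let v₀ … vₙ₋₁ ∈ K be linearly independent over the constants K^𝔤 and suppose n > e.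
-- The coaction vectors ∂(vᵢ) ∈ K ⊗ H ≅ Kᵉ are then K-linearly dependent, i.e. there is a
-- nontrivial relation ∑ᵢ aᵢ ∂(vᵢ) = 0 with aᵢ ∈ K.  We show, by an Artin-style induction
-- on n, that every such relation is zero:
--  * relations are stable under ∂: ∑ᵢ ∂(aᵢ)ₛ ∂(vᵢ) = 0 for every s.  Applying ∂ to the
--    relation and using coassociativity shows that the matrix ∑ᵢ ∂(aᵢ)ₛ ∂(vᵢ)ᵣ is killed by
--    the Galois map γ(x ⊗ y) = (x ⊗ 1)·μ(y) of H, which is invertible thanks to the antipode;
--  * if a₀ = 1, each ∂(a)ₛ − uₛ·a is a relation with vanishing first coefficient, hence zero
--    by induction; so all aᵢ are constants, and applying the counit turns the relation into
--    ∑ᵢ aᵢ vᵢ = 0 with a₀ = 1, contradicting independence.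
-- K has no decidable equality, so case distinctions are made in the double-negation monad;
-- since n ≤ e is decidable this costs nothing at the end.

open import Defs
open import Level using (Level; _⊔_)
open import Algebra.Morphism.Structures using (module RingMorphisms)
open import Data.Bool.Base using (true; false)
open import Data.Empty using (⊥)
open import Data.Fin.Base using (Fin; zero; suc; punchIn)
open import Data.Fin.Properties using (_≟_)
open import Data.Nat.Base using (ℕ; zero; suc; _<_; s≤s)
open import Data.Nat.Properties using (m<n⇒m<1+n; _≤?_; ≰⇒>)
open import Data.Product.Base using (Σ; ∃; _×_; _,_)
open import Data.Sum.Base using (_⊎_; inj₁; inj₂)
open import Data.Vec.Functional using (insertAt; _∷_)
open import Data.Vec.Functional.Properties using (insertAt-lookup; insertAt-punchIn)
open import Function.Base using (_∘_; id)
open import Relation.Nullary.Negation using (¬_; contradiction; negated-stable; ¬¬-map)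
open import Relation.Nullary.Decidable
  using (yes; no; does; ¬¬-excluded-middle; decidable-stable)
import Algebra.Properties.Semiring.Sum as SemiringSum
import Algebra.Properties.Ring as RingProperties
import Algebra.Solver.CommutativeMonoid as CommutativeMonoidSolver
import Relation.Binary.Reasoning.Setoid as SetoidReasoning

-- Classical reasoning in the double-negation monad.  The bind is level-polymorphic
-- (the library's ¬¬-Monad lives at a single level), which enables do-notation below.

_>>=_ : ∀ {a b} {A : Set a} {B : Set b} → ¬ ¬ A → (A → ¬ ¬ B) → ¬ ¬ B
m >>= f = negated-stable (¬¬-map f m)

return : ∀ {a} {A : Set a} → A → ¬ ¬ A
return = contradiction

¬¬-all : ∀ {a n} {P : Fin n → Set a} → (∀ i → ¬ ¬ P i) → ¬ ¬ (∀ i → P i)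
¬¬-all {n = zero}  h = return λ ()
¬¬-all {n = suc n} h = do
  p₀ ← h zero
  ps ← ¬¬-all (h ∘ suc)
  return λ { zero → p₀ ; (suc i) → ps i }

¬¬-all-or-counterexample : ∀ {a n} (P : Fin n → Set a) →
                           ¬ ¬ ((∀ i → P i) ⊎ ∃ λ i → ¬ P i)
¬¬-all-or-counterexample P = ¬¬-excluded-middle >>= λ where
  (yes counterexample) → return (inj₂ counterexample)
  (no none)            → ¬¬-map inj₁ (¬¬-all λ i ¬Pi → none (i , ¬Pi))

module FiniteSums {c ℓ} (F : Field c ℓ) where
  open Field F hiding (zero)
  open SemiringSum semiring public
    using (sum; sum-syntax; sum-cong-≋; sum-replicate-zero; sum-remove; ∑-comm; ∑-distrib-+;
           *-distribˡ-sum; *-distribʳ-sum)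
  open RingProperties ring using (-0#≈0#; -‿+-comm)
  open SetoidReasoning setoid

  ∑-zero : ∀ {n} {f : Fin n → Carrier} → (∀ i → f i ≈ 0#) → sum f ≈ 0#
  ∑-zero {n} f≈0 = trans (sum-cong-≋ f≈0) (sum-replicate-zero n)

  ∑-neg : ∀ {n} (f : Fin n → Carrier) → ∑[ i < n ] (- f i) ≈ - sum f
  ∑-neg {zero}  f = sym -0#≈0#
  ∑-neg {suc n} f = trans (+-congˡ (∑-neg (f ∘ suc))) (-‿+-comm (f zero) (sum (f ∘ suc)))

  ∑-distrib-- : ∀ {n} (f g : Fin n → Carrier) → ∑[ i < n ] (f i - g i) ≈ sum f - sum g
  ∑-distrib-- f g = trans (∑-distrib-+ f (λ i → - g i)) (+-congˡ (∑-neg g))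

  ∑-δ : ∀ {n} (f : Fin n → Carrier) i → ∑[ j < n ] (f j * δ F j i) ≈ f i
  ∑-δ {suc n} f zero = begin
    f zero * 1# + ∑[ j < n ] (f (suc j) * 0#)
      ≈⟨ +-cong (*-identityʳ _) (∑-zero {f = λ j → f (suc j) * 0#} λ j → zeroʳ _) ⟩
    f zero + 0#                                 ≈⟨ +-identityʳ _ ⟩
    f zero                                      ∎
  ∑-δ {suc n} f (suc i) = begin
    f zero * 0# + ∑[ j < n ] (f (suc j) * δ F j i)  ≈⟨ +-cong (zeroʳ _) (∑-δ (f ∘ suc) i) ⟩
    0# + f (suc i)                                   ≈⟨ +-identityˡ _ ⟩
    f (suc i)                                        ∎

  ∑∑-δδ : ∀ {m n} (X : Fin m → Fin n → Carrier) i j →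
          ∑[ s < m ] ∑[ r < n ] (X s r * (δ F s i * δ F r j)) ≈ X i j
  ∑∑-δδ {m} {n} X i j = begin
    ∑[ s < m ] ∑[ r < n ] (X s r * (δ F s i * δ F r j))
      ≈⟨ sum-cong-≋ (λ s → sum-cong-≋ λ r → reorder (X s r) (δ F s i) (δ F r j)) ⟩
    ∑[ s < m ] ∑[ r < n ] (X s r * δ F r j * δ F s i)
      ≈⟨ sum-cong-≋ (λ s → sym (*-distribʳ-sum (δ F s i) λ r → X s r * δ F r j)) ⟩
    ∑[ s < m ] (∑[ r < n ] (X s r * δ F r j) * δ F s i)
      ≈⟨ sum-cong-≋ (λ s → *-congʳ (∑-δ (X s) j)) ⟩
    ∑[ s < m ] (X s j * δ F s i)
      ≈⟨ ∑-δ (λ s → X s j) i ⟩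
    X i j ∎
    where
    reorder : ∀ x a b → x * (a * b) ≈ x * b * a
    reorder x a b = trans (*-congˡ (*-comm a b)) (sym (*-assoc x b a))

  ∑*∑ : ∀ {m n} (f : Fin m → Carrier) (g : Fin n → Carrier) →
        sum f * sum g ≈ ∑[ i < m ] ∑[ j < n ] (f i * g j)
  ∑*∑ f g = trans (*-distribʳ-sum (sum g) f) (sum-cong-≋ λ i → *-distribˡ-sum (f i) g)

  *-distribˡ-∑∑ : ∀ {m n} x (f : Fin m → Fin n → Carrier) →
                  x * ∑[ i < m ] ∑[ j < n ] f i j ≈ ∑[ i < m ] ∑[ j < n ] (x * f i j)
  *-distribˡ-∑∑ {n = n} x f = trans (*-distribˡ-sum x λ i → ∑[ j < n ] f i j)
                                    (sum-cong-≋ λ i → *-distribˡ-sum x (f i))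

  *-distribʳ-∑∑ : ∀ {m n} x (f : Fin m → Fin n → Carrier) →
                  (∑[ i < m ] ∑[ j < n ] f i j) * x ≈ ∑[ i < m ] ∑[ j < n ] (f i j * x)
  *-distribʳ-∑∑ {n = n} x f = trans (*-distribʳ-sum x λ i → ∑[ j < n ] f i j)
                                    (sum-cong-≋ λ i → *-distribʳ-sum x (f i))

  -- Interchange of a block of summations with another block (block sizes in the
  -- subscript): the index bookkeeping needed for the Hopf algebra computations.
  ∑-interchange₁₂ : ∀ {n₁ n₂ n₃} (G : Fin n₁ → Fin n₂ → Fin n₃ → Carrier) →
    ∑[ x < n₁ ] ∑[ y < n₂ ] ∑[ z < n₃ ] G x y z ≈ ∑[ y < n₂ ] ∑[ z < n₃ ] ∑[ x < n₁ ] G x y z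
  ∑-interchange₁₂ G = trans (∑-comm λ x y → sum (G x y)) (sum-cong-≋ λ y → ∑-comm λ x z → G x y z)

  ∑-interchange₁₃ : ∀ {n₁ n₂ n₃ n₄} (G : Fin n₁ → Fin n₂ → Fin n₃ → Fin n₄ → Carrier) →
    ∑[ x < n₁ ] ∑[ y < n₂ ] ∑[ z < n₃ ] ∑[ w < n₄ ] G x y z w ≈
    ∑[ y < n₂ ] ∑[ z < n₃ ] ∑[ w < n₄ ] ∑[ x < n₁ ] G x y z w
  ∑-interchange₁₃ {n₁} {n₂} {n₃} {n₄} G =
    trans (∑-comm λ x y → ∑[ z < n₃ ] ∑[ w < n₄ ] G x y z w)
          (sum-cong-≋ λ y → ∑-interchange₁₂ {n₁} {n₃} {n₄} λ x z w → G x y z w)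

  ∑-interchange₂₂ : ∀ {n₁ n₂ n₃ n₄} (G : Fin n₁ → Fin n₂ → Fin n₃ → Fin n₄ → Carrier) →
    ∑[ x < n₁ ] ∑[ y < n₂ ] ∑[ z < n₃ ] ∑[ w < n₄ ] G x y z w ≈
    ∑[ z < n₃ ] ∑[ w < n₄ ] ∑[ x < n₁ ] ∑[ y < n₂ ] G x y z w
  ∑-interchange₂₂ {n₁} {n₂} {n₃} {n₄} G =
    trans (sum-cong-≋ λ x → ∑-interchange₁₂ (G x))
          (∑-interchange₁₂ {n₁} {n₃} {n₄} λ x z w → ∑[ y < n₂ ] G x y z w)

  ∑-interchange₂₃ : ∀ {n₁ n₂ n₃ n₄ n₅} (G : Fin n₁ → Fin n₂ → Fin n₃ → Fin n₄ → Fin n₅ → Carrier) →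
    ∑[ x < n₁ ] ∑[ y < n₂ ] ∑[ z < n₃ ] ∑[ w < n₄ ] ∑[ v < n₅ ] G x y z w v ≈
    ∑[ z < n₃ ] ∑[ w < n₄ ] ∑[ v < n₅ ] ∑[ x < n₁ ] ∑[ y < n₂ ] G x y z w v
  ∑-interchange₂₃ {n₁} {n₂} {n₃} {n₄} {n₅} G =
    trans (sum-cong-≋ λ x → ∑-interchange₁₃ (G x))
          (∑-interchange₁₃ {n₁} {n₃} {n₄} {n₅} λ x z w v → ∑[ y < n₂ ] G x y z w v)

module LinearDependence {c ℓ} (F : Field c ℓ) where
  open Field F hiding (zero)
  open FiniteSums F
  open RingProperties ring using (-‿distribˡ-*; x[y-z]≈xy-xz; [y-z]x≈yx-zx; x∙y⁻¹≈ε⇒x≈y)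
  open SetoidReasoning setoid

  record IsRelation {n e} (v : Fin n → Fin e → Carrier) (a : Fin n → Carrier) : Set ℓ where
    constructor relation
    field vanishes : ∀ j → ∑[ i < n ] (a i * v i j) ≈ 0#
  open IsRelation public

  NontrivialRelation : ∀ {n e} → (Fin n → Fin e → Carrier) → Set (c ⊔ ℓ)
  NontrivialRelation v = Σ _ λ a → IsRelation v a × ∃ λ i → ¬ a i ≈ 0#

  relation-scale : ∀ {n e} {v : Fin n → Fin e → Carrier} {a} →
                   IsRelation v a → ∀ x → IsRelation v (λ i → x * a i)
  relation-scale {n} {v = v} {a} rel x = relation λ j → begin
    ∑[ i < n ] (x * a i * v i j)   ≈⟨ sum-cong-≋ (λ i → *-assoc x (a i) (v i j)) ⟩
    ∑[ i < n ] (x * (a i * v i j)) ≈⟨ *-distribˡ-sum x (λ i → a i * v i j) ⟨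
    x * ∑[ i < n ] (a i * v i j)   ≈⟨ *-congˡ (vanishes rel j) ⟩
    x * 0#                         ≈⟨ zeroʳ x ⟩
    0#                             ∎

  relation-sub : ∀ {n e} {v : Fin n → Fin e → Carrier} {a b} →
                 IsRelation v a → IsRelation v b → IsRelation v (λ i → a i - b i)
  relation-sub {n} {v = v} {a} {b} rel-a rel-b = relation λ j → begin
    ∑[ i < n ] ((a i - b i) * v i j)
      ≈⟨ sum-cong-≋ (λ i → [y-z]x≈yx-zx (v i j) (a i) (b i)) ⟩
    ∑[ i < n ] (a i * v i j - b i * v i j)
      ≈⟨ ∑-distrib-- (λ i → a i * v i j) (λ i → b i * v i j) ⟩
    ∑[ i < n ] (a i * v i j) - ∑[ i < n ] (b i * v i j)
      ≈⟨ +-cong (vanishes rel-a j) (-‿cong (vanishes rel-b j)) ⟩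
    0# - 0#
      ≈⟨ -‿inverseʳ 0# ⟩
    0# ∎

  relation-tail : ∀ {n e} {v : Fin (suc n) → Fin e → Carrier} {a} →
                  IsRelation v a → a zero ≈ 0# → IsRelation (v ∘ suc) (a ∘ suc)
  relation-tail {n} {v = v} {a} rel a₀≈0 = relation λ j → begin
    ∑[ i < n ] (a (suc i) * v (suc i) j)                    ≈⟨ +-identityˡ _ ⟨
    0# + ∑[ i < n ] (a (suc i) * v (suc i) j)               ≈⟨ +-congʳ (trans (*-congʳ a₀≈0) (zeroˡ _)) ⟨
    a zero * v zero j + ∑[ i < n ] (a (suc i) * v (suc i) j) ≈⟨ vanishes rel j ⟩
    0#                                                      ∎

  ∑-insertAt : ∀ {n} (a : Fin n → Carrier) p x (w : Fin (suc n) → Carrier) →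
    ∑[ i < suc n ] (insertAt a p x i * w i) ≈ x * w p + ∑[ i < n ] (a i * w (punchIn p i))
  ∑-insertAt a p x w = trans (sum-remove {i = p} λ i → insertAt a p x i * w i)
    (+-cong (*-congʳ (reflexive (insertAt-lookup a p x)))
            (sum-cong-≋ λ i → *-congʳ (reflexive (insertAt-punchIn a p x i))))

  extend-by-zero-coordinate : ∀ {n e} (v : Fin n → Fin (suc e) → Carrier) →
                              (∀ i → v i zero ≈ 0#) →
                              NontrivialRelation (λ i j → v i (suc j)) → NontrivialRelation v
  extend-by-zero-coordinate v column≈0 (a , rel , nonzero) = a , relation rel′ , nonzero
    where
    rel′ : ∀ j → ∑[ i < _ ] (a i * v i j) ≈ 0#
    rel′ zero    = ∑-zero λ i → trans (*-congˡ (column≈0 i)) (zeroʳ (a i))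
    rel′ (suc j) = vanishes rel j

  -- Gaussian elimination with pivot v p 0 (of inverse y): clear the first coordinate of
  -- every other vector by subtracting a multiple of v p, then drop it and v p
  clearColumn : ∀ {n e} → (Fin (suc n) → Fin (suc e) → Carrier) → Fin (suc n) → Carrier →
                Fin n → Fin e → Carrier
  clearColumn v p y i j = v (punchIn p i) (suc j) - v (punchIn p i) zero * (y * v p (suc j))

  -- a nontrivial relation among the cleared vectors lifts to one among v, the coefficient
  -- of v p compensating the first coordinates
  eliminate-pivot : ∀ {n e} (v : Fin (suc n) → Fin (suc e) → Carrier) p y → v p zero * y ≈ 1# →
                    NontrivialRelation (clearColumn v p y) → NontrivialRelation v
  eliminate-pivot {n} v p y pivot-inverse (a , rel , i , aᵢ≉0) =
    insertAt a p (- (S * y)) , relation rel′ , punchIn p i ,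
    aᵢ≉0 ∘ trans (sym (reflexive (insertAt-punchIn a p _ i)))
    where
    S : Carrier
    S = ∑[ i < n ] (a i * v (punchIn p i) zero)
    rest : ∀ j → ∑[ i < n ] (a i * v (punchIn p i) (suc j)) ≈ S * (y * v p (suc j))
    rest j = x∙y⁻¹≈ε⇒x≈y _ _ (begin
      ∑[ i < n ] (a i * A i) - S * q
        ≈⟨ +-congˡ (-‿cong S*q) ⟨
      ∑[ i < n ] (a i * A i) - ∑[ i < n ] (a i * (B i * q))
        ≈⟨ ∑-distrib-- (λ i → a i * A i) (λ i → a i * (B i * q)) ⟨
      ∑[ i < n ] (a i * A i - a i * (B i * q))
        ≈⟨ sum-cong-≋ (λ i → x[y-z]≈xy-xz (a i) (A i) (B i * q)) ⟨
      ∑[ i < n ] (a i * clearColumn v p y i j)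
        ≈⟨ vanishes rel j ⟩
      0# ∎)
      where
      A B : Fin n → Carrier
      A i = v (punchIn p i) (suc j)
      B i = v (punchIn p i) zero
      q : Carrier
      q = y * v p (suc j)
      S*q : ∑[ i < n ] (a i * (B i * q)) ≈ S * q
      S*q = trans (sum-cong-≋ λ i → sym (*-assoc (a i) (B i) q))
                  (sym (*-distribʳ-sum q λ i → a i * B i))
    rel′ : ∀ j → ∑[ i < suc n ] (insertAt a p (- (S * y)) i * v i j) ≈ 0#
    rel′ zero = begin
      ∑[ i < suc n ] (insertAt a p (- (S * y)) i * v i zero) ≈⟨ ∑-insertAt a p _ (λ i → v i zero) ⟩
      - (S * y) * v p zero + S                             ≈⟨ +-congʳ (-‿distribˡ-* (S * y) _) ⟨
      - (S * y * v p zero) + S                             ≈⟨ +-congʳ (-‿cong pivot-cancels) ⟩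
      - S + S                                              ≈⟨ -‿inverseˡ S ⟩
      0#                                                   ∎
      where
      pivot-cancels : S * y * v p zero ≈ S
      pivot-cancels = begin
        S * y * v p zero   ≈⟨ *-assoc S y _ ⟩
        S * (y * v p zero) ≈⟨ *-congˡ (trans (*-comm y _) pivot-inverse) ⟩
        S * 1#             ≈⟨ *-identityʳ S ⟩
        S                  ∎
    rel′ (suc j) = begin
      ∑[ i < suc n ] (insertAt a p (- (S * y)) i * v i (suc j))
        ≈⟨ ∑-insertAt a p _ (λ i → v i (suc j)) ⟩
      - (S * y) * v p (suc j) + ∑[ i < n ] (a i * v (punchIn p i) (suc j))
        ≈⟨ +-cong (trans (sym (-‿distribˡ-* (S * y) _)) (-‿cong (*-assoc S y _))) (rest j) ⟩
      - (S * (y * v p (suc j))) + S * (y * v p (suc j))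
        ≈⟨ -‿inverseˡ _ ⟩
      0# ∎

  -- More than e vectors in Fᵉ (classically) satisfy a nontrivial relation: induction on e,
  -- either the first coordinates all vanish or one of them serves as a pivot.
  more-vectors-than-coordinates : ∀ {e n} → e < n → (v : Fin n → Fin e → Carrier) →
                                  ¬ ¬ NontrivialRelation v
  more-vectors-than-coordinates {zero} {suc n} _ v =
    return ((λ _ → 1#) , relation (λ ()) , zero , 1≉0)
  more-vectors-than-coordinates {suc e} {suc n} (s≤s e<n) v =
    ¬¬-all-or-counterexample (λ i → v i zero ≈ 0#) >>= λ where
      (inj₁ column≈0) → ¬¬-map (extend-by-zero-coordinate v column≈0)
                               (more-vectors-than-coordinates (m<n⇒m<1+n e<n) λ i j → v i (suc j))
      (inj₂ (p , pivot≉0)) → let (y , pivot-inverse) = inverse (v p zero) pivot≉0 in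
                             ¬¬-map (eliminate-pivot v p y pivot-inverse)
                                    (more-vectors-than-coordinates e<n (clearColumn v p y))

-- The Galois map γ : H ⊗ H → H ⊗ H, γ(x ⊗ y) = (x ⊗ 1)·μ(y), and its inverse
-- β(x ⊗ y) = (x ⊗ 1)·(S ⊗ id)(μ(y)), as matrices in the basis (b_l ⊗ b_j).
module GaloisMatrix {c ℓ} {k : Field c ℓ} {e : ℕ} (H : FiniteHopfAlgebra k e) where
  open Field k hiding (zero)
  open FiniteHopfAlgebra H
  open FiniteSums k
  open CommutativeMonoidSolver *-commutativeMonoid using (solve; _⊜_) renaming (_⊕_ to _⊗_)
  open SetoidReasoning setoid

  -- γ(b_s ⊗ b_r) = ∑_{j,l} galois s r j l · b_l ⊗ b_j
  galois : Fin e → Fin e → Fin e → Fin e → Carrier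
  galois s r j l = ∑[ t < e ] (Δ r t j * m s t l)

  -- β(b_l ⊗ b_j) = ∑_{s′,r′} galois⁻¹ j l s′ r′ · b_s′ ⊗ b_r′
  galois⁻¹ : Fin e → Fin e → Fin e → Fin e → Carrier
  galois⁻¹ j l s′ r′ = ∑[ p < e ] ∑[ w < e ] (Δ j p r′ * S p w * m l w s′)

  -- the first step of β ∘ γ = id: coassociativity in j and associativity in l
  reassociate : ∀ s r s′ r′ t p w →
    ∑[ j < e ] ∑[ l < e ] ((Δ r t j * m s t l) * (Δ j p r′ * S p w * m l w s′)) ≈
    ∑[ x < e ] ∑[ l < e ] ((Δ r x r′ * Δ x t p) * (m t w l * m s l s′ * S p w))
  reassociate s r s′ r′ t p w = begin
    ∑[ j < e ] ∑[ l < e ] ((Δ r t j * m s t l) * (Δ j p r′ * S p w * m l w s′))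
      ≈⟨ sum-cong-≋ (λ j → sum-cong-≋ λ l →
           regroup (Δ r t j) (m s t l) (Δ j p r′) (S p w) (m l w s′)) ⟩
    ∑[ j < e ] ∑[ l < e ] ((Δ r t j * Δ j p r′) * (m s t l * m l w s′ * S p w))
      ≈⟨ ∑*∑ (λ j → Δ r t j * Δ j p r′) (λ l → m s t l * m l w s′ * S p w) ⟨
    ∑[ j < e ] (Δ r t j * Δ j p r′) * ∑[ l < e ] (m s t l * m l w s′ * S p w)
      ≈⟨ *-cong (sym (Δ-coassoc r t p r′)) associate ⟩
    ∑[ x < e ] (Δ r x r′ * Δ x t p) * ∑[ l < e ] (m t w l * m s l s′ * S p w)
      ≈⟨ ∑*∑ (λ x → Δ r x r′ * Δ x t p) (λ l → m t w l * m s l s′ * S p w) ⟩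
    ∑[ x < e ] ∑[ l < e ] ((Δ r x r′ * Δ x t p) * (m t w l * m s l s′ * S p w)) ∎
    where
    associate : ∑[ l < e ] (m s t l * m l w s′ * S p w) ≈ ∑[ l < e ] (m t w l * m s l s′ * S p w)
    associate = begin
      ∑[ l < e ] (m s t l * m l w s′ * S p w) ≈⟨ *-distribʳ-sum (S p w) (λ l → m s t l * m l w s′) ⟨
      ∑[ l < e ] (m s t l * m l w s′) * S p w ≈⟨ *-congʳ (m-assoc s t w s′) ⟩
      ∑[ l < e ] (m t w l * m s l s′) * S p w ≈⟨ *-distribʳ-sum (S p w) (λ l → m t w l * m s l s′) ⟩
      ∑[ l < e ] (m t w l * m s l s′ * S p w) ∎
    regroup : ∀ a b c′ x y → (a * b) * (c′ * x * y) ≈ (a * c′) * ((b * y) * x)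
    regroup = solve 5 (λ a b c′ x y → ((a ⊗ b) ⊗ ((c′ ⊗ x) ⊗ y)) ⊜ ((a ⊗ c′) ⊗ ((b ⊗ y) ⊗ x))) refl

  -- the second step: the antipode axiom collapses the sum over t, p, w
  antipode-collapse : ∀ s r s′ r′ x l →
    ∑[ t < e ] ∑[ p < e ] ∑[ w < e ] ((Δ r x r′ * Δ x t p) * (m t w l * m s l s′ * S p w)) ≈
    (Δ r x r′ * m s l s′) * (ε x * u l)
  antipode-collapse s r s′ r′ x l = begin
    ∑[ t < e ] ∑[ p < e ] ∑[ w < e ] ((Δ r x r′ * Δ x t p) * (m t w l * m s l s′ * S p w))
      ≈⟨ sum-cong-≋ (λ t → sum-cong-≋ λ p → sum-cong-≋ λ w →
           regroup (Δ r x r′) (Δ x t p) (m t w l) (m s l s′) (S p w)) ⟩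
    ∑[ t < e ] ∑[ p < e ] ∑[ w < e ] (a * (Δ x t p * S p w * m t w l))
      ≈⟨ sum-cong-≋ (λ t → *-distribˡ-∑∑ a λ p w → Δ x t p * S p w * m t w l) ⟨
    ∑[ t < e ] (a * ∑[ p < e ] ∑[ w < e ] (Δ x t p * S p w * m t w l))
      ≈⟨ *-distribˡ-sum a (λ t → ∑[ p < e ] ∑[ w < e ] (Δ x t p * S p w * m t w l)) ⟨
    a * ∑[ t < e ] ∑[ p < e ] ∑[ w < e ] (Δ x t p * S p w * m t w l)
      ≈⟨ *-congˡ (S-antipodeʳ x l) ⟩
    a * (ε x * u l) ∎
    where
    a : Carrier
    a = Δ r x r′ * m s l s′
    regroup : ∀ a b c′ x y → (a * b) * (c′ * x * y) ≈ (a * x) * (b * y * c′)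
    regroup = solve 5 (λ a b c′ x y → ((a ⊗ b) ⊗ ((c′ ⊗ x) ⊗ y)) ⊜ ((a ⊗ x) ⊗ ((b ⊗ y) ⊗ c′))) refl

  -- β ∘ γ = id; the remaining sums are evaluated by the counit and unit axioms
  galois⁻¹-inverts-galois : ∀ s r s′ r′ →
    ∑[ j < e ] ∑[ l < e ] (galois s r j l * galois⁻¹ j l s′ r′) ≈ δ k s s′ * δ k r r′
  galois⁻¹-inverts-galois s r s′ r′ = begin
    ∑[ j < e ] ∑[ l < e ] (galois s r j l * galois⁻¹ j l s′ r′)
      ≈⟨ sum-cong-≋ (λ j → sum-cong-≋ λ l → expand j l) ⟩
    ∑[ j < e ] ∑[ l < e ] ∑[ t < e ] ∑[ p < e ] ∑[ w < e ] G j l t p w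
      ≈⟨ ∑-interchange₂₃ G ⟩
    ∑[ t < e ] ∑[ p < e ] ∑[ w < e ] ∑[ j < e ] ∑[ l < e ] G j l t p w
      ≈⟨ sum-cong-≋ (λ t → sum-cong-≋ λ p → sum-cong-≋ λ w → reassociate s r s′ r′ t p w) ⟩
    ∑[ t < e ] ∑[ p < e ] ∑[ w < e ] ∑[ x < e ] ∑[ l < e ] G′ x l t p w
      ≈⟨ ∑-interchange₂₃ G′ ⟨
    ∑[ x < e ] ∑[ l < e ] ∑[ t < e ] ∑[ p < e ] ∑[ w < e ] G′ x l t p w
      ≈⟨ sum-cong-≋ (λ x → sum-cong-≋ λ l → antipode-collapse s r s′ r′ x l) ⟩
    ∑[ x < e ] ∑[ l < e ] ((Δ r x r′ * m s l s′) * (ε x * u l))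
      ≈⟨ sum-cong-≋ (λ x → sum-cong-≋ λ l →
           trans (regroup (Δ r x r′) (m s l s′) (ε x) (u l)) (*-congˡ (*-congˡ (m-comm s l s′)))) ⟩
    ∑[ x < e ] ∑[ l < e ] ((ε x * Δ r x r′) * (u l * m l s s′))
      ≈⟨ ∑*∑ (λ x → ε x * Δ r x r′) (λ l → u l * m l s s′) ⟨
    ∑[ x < e ] (ε x * Δ r x r′) * ∑[ l < e ] (u l * m l s s′)
      ≈⟨ *-cong (ε-counitˡ r r′) (m-unit s s′) ⟩
    δ k r r′ * δ k s s′
      ≈⟨ *-comm _ _ ⟩
    δ k s s′ * δ k r r′ ∎
    where
    G G′ : Fin e → Fin e → Fin e → Fin e → Fin e → Carrier
    G j l t p w = (Δ r t j * m s t l) * (Δ j p r′ * S p w * m l w s′)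
    G′ x l t p w = (Δ r x r′ * Δ x t p) * (m t w l * m s l s′ * S p w)
    expand : ∀ j l → galois s r j l * galois⁻¹ j l s′ r′ ≈
                     ∑[ t < e ] ∑[ p < e ] ∑[ w < e ] G j l t p w
    expand j l = trans (*-distribʳ-sum (galois⁻¹ j l s′ r′) λ t → Δ r t j * m s t l)
                       (sum-cong-≋ λ t → *-distribˡ-∑∑ (Δ r t j * m s t l) λ p w →
                                          Δ j p r′ * S p w * m l w s′)
    regroup : ∀ a b x y → (a * b) * (x * y) ≈ (x * a) * (y * b)
    regroup = solve 4 (λ a b x y → ((a ⊗ b) ⊗ (x ⊗ y)) ⊜ ((x ⊗ a) ⊗ (y ⊗ b))) refl

module GFieldRelations {c ℓ c′ ℓ′} {k : Field c ℓ} {e : ℕ} {H : FiniteHopfAlgebra k e}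
                       (G : GField k H c′ ℓ′) where
  open GField G
  open Field K hiding (zero)
  open FiniteSums K
  open LinearDependence K
  open GaloisMatrix H using (galois; galois⁻¹; galois⁻¹-inverts-galois)
  open RingMorphisms k.rawRing rawRing using (module IsRingHomomorphism)
  open IsRingHomomorphism ι-hom using (+-homo; *-homo; 0#-homo; 1#-homo; ⟦⟧-cong)
  open RingProperties ring using (x∙y⁻¹≈ε⇒x≈y; x≈y⇒x∙y⁻¹≈ε)
  open CommutativeMonoidSolver *-commutativeMonoid using (solve; _⊜_) renaming (_⊕_ to _⊗_)
  open SetoidReasoning setoid
  module k∑ = FiniteSums k

  ι-∑ : ∀ {n} (f : Fin n → k.Carrier) → ι (k∑.sum f) ≈ sum (ι ∘ f)
  ι-∑ {zero}  f = 0#-homo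
  ι-∑ {suc n} f = trans (+-homo _ _) (+-congˡ (ι-∑ (f ∘ suc)))

  ι-δ : ∀ {n} (i j : Fin n) → ι (δ k i j) ≈ δ K i j
  ι-δ i j with does (i ≟ j)
  ... | true  = 1#-homo
  ... | false = 0#-homo

  ∂-0 : ∀ j → ∂ 0# j ≈ 0#
  ∂-0 j = begin
    ∂ 0# j                  ≈⟨ ∂-cong 0#-homo j ⟨
    ∂ (ι k.0#) j            ≈⟨ ∂-k k.0# j ⟩
    ι k.0# * ι (H.u j)      ≈⟨ *-congʳ 0#-homo ⟩
    0# * ι (H.u j)          ≈⟨ zeroˡ _ ⟩
    0#                      ∎

  ∂-∑ : ∀ {n} (f : Fin n → Carrier) j → ∂ (sum f) j ≈ ∑[ i < n ] ∂ (f i) j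
  ∂-∑ {zero}  f j = ∂-0 j
  ∂-∑ {suc n} f j = trans (∂-+ _ _ j) (+-congˡ (∂-∑ (f ∘ suc) j))

  ι-galois⁻¹-inverts-galois : ∀ s r s′ r′ →
    ∑[ j < e ] ∑[ l < e ] (ι (galois s r j l) * ι (galois⁻¹ j l s′ r′)) ≈ δ K s s′ * δ K r r′
  ι-galois⁻¹-inverts-galois s r s′ r′ = sym (begin
    δ K s s′ * δ K r r′                     ≈⟨ *-cong (ι-δ s s′) (ι-δ r r′) ⟨
    ι (δ k s s′) * ι (δ k r r′)             ≈⟨ *-homo _ _ ⟨
    ι (δ k s s′ k.* δ k r r′)               ≈⟨ ⟦⟧-cong (k.sym (galois⁻¹-inverts-galois s r s′ r′)) ⟩
    ι (k∑.sum λ j → k∑.sum λ l → T j l)     ≈⟨ ι-∑ (λ j → k∑.sum (T j)) ⟩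
    ∑[ j < e ] ι (k∑.sum λ l → T j l)       ≈⟨ sum-cong-≋ (λ j → ι-∑ (T j)) ⟩
    ∑[ j < e ] ∑[ l < e ] ι (T j l)
      ≈⟨ sum-cong-≋ (λ j → sum-cong-≋ λ l → *-homo (galois s r j l) (galois⁻¹ j l s′ r′)) ⟩
    ∑[ j < e ] ∑[ l < e ] (ι (galois s r j l) * ι (galois⁻¹ j l s′ r′)) ∎)
    where
    T : Fin e → Fin e → k.Carrier
    T j l = galois s r j l k.* galois⁻¹ j l s′ r′

  galois-injective : (X : Fin e → Fin e → Carrier) →
                     (∀ j l → ∑[ s < e ] ∑[ r < e ] (X s r * ι (galois s r j l)) ≈ 0#) →
                     ∀ s′ r′ → X s′ r′ ≈ 0#
  galois-injective X killed s′ r′ = begin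
    X s′ r′
      ≈⟨ ∑∑-δδ X s′ r′ ⟨
    ∑[ s < e ] ∑[ r < e ] (X s r * (δ K s s′ * δ K r r′))
      ≈⟨ sum-cong-≋ (λ s → sum-cong-≋ λ r → *-congˡ (ι-galois⁻¹-inverts-galois s r s′ r′)) ⟨
    ∑[ s < e ] ∑[ r < e ] (X s r * ∑[ j < e ] ∑[ l < e ] ιT s r j l)
      ≈⟨ sum-cong-≋ (λ s → sum-cong-≋ λ r → trans (*-distribˡ-∑∑ (X s r) (ιT s r))
           (sum-cong-≋ λ j → sum-cong-≋ λ l →
              sym (*-assoc (X s r) (ι (galois s r j l)) (ι (galois⁻¹ j l s′ r′))))) ⟩
    ∑[ s < e ] ∑[ r < e ] ∑[ j < e ] ∑[ l < e ] Y s r j l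
      ≈⟨ ∑-interchange₂₂ Y ⟩
    ∑[ j < e ] ∑[ l < e ] ∑[ s < e ] ∑[ r < e ] Y s r j l
      ≈⟨ sum-cong-≋ (λ j → sum-cong-≋ λ l →
           *-distribʳ-∑∑ (ι (galois⁻¹ j l s′ r′)) λ s r → X s r * ι (galois s r j l)) ⟨
    ∑[ j < e ] ∑[ l < e ]
      (∑[ s < e ] ∑[ r < e ] (X s r * ι (galois s r j l)) * ι (galois⁻¹ j l s′ r′))
      ≈⟨ ∑-zero (λ j → ∑-zero λ l → trans (*-congʳ (killed j l)) (zeroˡ _)) ⟩
    0# ∎
    where
    Y : Fin e → Fin e → Fin e → Fin e → Carrier
    Y s r j l = X s r * ι (galois s r j l) * ι (galois⁻¹ j l s′ r′)
    ιT : Fin e → Fin e → Fin e → Fin e → Carrier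
    ιT s r j l = ι (galois s r j l) * ι (galois⁻¹ j l s′ r′)

  -- ∂ of x · ∂(y)_j, by multiplicativity and coassociativity of ∂, is γ applied to
  -- the matrix ∂(x)ₛ ∂(y)ᵣ
  ∂-twisted : ∀ x y j l →
    ∂ (x * ∂ y j) l ≈ ∑[ s < e ] ∑[ r < e ] (∂ x s * ∂ y r * ι (galois s r j l))
  ∂-twisted x y j l = begin
    ∂ (x * ∂ y j) l
      ≈⟨ ∂-* x (∂ y j) l ⟩
    ∑[ s < e ] ∑[ t < e ] (∂ x s * ∂ (∂ y j) t * ι (H.m s t l))
      ≈⟨ sum-cong-≋ (λ s → sum-cong-≋ λ t →
           *-congʳ {ι (H.m s t l)} (*-congˡ {∂ x s} (∂-coassoc y t j))) ⟩
    ∑[ s < e ] ∑[ t < e ] (∂ x s * ∑[ r < e ] (∂ y r * ι (H.Δ r t j)) * ι (H.m s t l))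
      ≈⟨ sum-cong-≋ (λ s → sum-cong-≋ λ t → expand s t) ⟩
    ∑[ s < e ] ∑[ t < e ] ∑[ r < e ] (∂ x s * ∂ y r * (ι (H.Δ r t j) * ι (H.m s t l)))
      ≈⟨ sum-cong-≋ (λ s → ∑-comm λ t r → ∂ x s * ∂ y r * (ι (H.Δ r t j) * ι (H.m s t l))) ⟩
    ∑[ s < e ] ∑[ r < e ] ∑[ t < e ] (∂ x s * ∂ y r * (ι (H.Δ r t j) * ι (H.m s t l)))
      ≈⟨ sum-cong-≋ (λ s → sum-cong-≋ λ r →
           *-distribˡ-sum (∂ x s * ∂ y r) λ t → ι (H.Δ r t j) * ι (H.m s t l)) ⟨
    ∑[ s < e ] ∑[ r < e ] (∂ x s * ∂ y r * ∑[ t < e ] (ι (H.Δ r t j) * ι (H.m s t l)))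
      ≈⟨ sum-cong-≋ (λ s → sum-cong-≋ λ r → *-congˡ (ι-galois s r)) ⟩
    ∑[ s < e ] ∑[ r < e ] (∂ x s * ∂ y r * ι (galois s r j l)) ∎
    where
    regroup : ∀ a b c′ d → a * (b * c′) * d ≈ a * b * (c′ * d)
    regroup = solve 4 (λ a b c′ d → ((a ⊗ (b ⊗ c′)) ⊗ d) ⊜ ((a ⊗ b) ⊗ (c′ ⊗ d))) refl
    expand : ∀ s t → ∂ x s * ∑[ r < e ] (∂ y r * ι (H.Δ r t j)) * ι (H.m s t l) ≈
                     ∑[ r < e ] (∂ x s * ∂ y r * (ι (H.Δ r t j) * ι (H.m s t l)))
    expand s t = trans (*-congʳ (*-distribˡ-sum (∂ x s) λ r → ∂ y r * ι (H.Δ r t j)))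
      (trans (*-distribʳ-sum (ι (H.m s t l)) λ r → ∂ x s * (∂ y r * ι (H.Δ r t j)))
             (sum-cong-≋ λ r → regroup (∂ x s) (∂ y r) (ι (H.Δ r t j)) (ι (H.m s t l))))
    ι-galois : ∀ s r → ∑[ t < e ] (ι (H.Δ r t j) * ι (H.m s t l)) ≈ ι (galois s r j l)
    ι-galois s r = sym (trans (ι-∑ λ t → H.Δ r t j k.* H.m s t l)
                              (sum-cong-≋ λ t → *-homo (H.Δ r t j) (H.m s t l)))

  -- Relations among the ∂(vᵢ) are stable under ∂: applying ∂ to ∑ aᵢ ∂(vᵢ)_j = 0 shows,
  -- by ∂-twisted, that γ kills the matrix X s r = ∑ᵢ ∂(aᵢ)ₛ ∂(vᵢ)ᵣ.
  ∂-relation : ∀ {n} {v : Fin n → Carrier} {a} →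
               IsRelation (∂ ∘ v) a → ∀ s → IsRelation (∂ ∘ v) (λ i → ∂ (a i) s)
  ∂-relation {n} {v} {a} rel s = relation (galois-injective X killed s)
    where
    X : Fin e → Fin e → Carrier
    X s r = ∑[ i < n ] (∂ (a i) s * ∂ (v i) r)
    killed : ∀ j l → ∑[ s < e ] ∑[ r < e ] (X s r * ι (galois s r j l)) ≈ 0#
    killed j l = begin
      ∑[ s < e ] ∑[ r < e ] (X s r * ι (galois s r j l))
        ≈⟨ sum-cong-≋ (λ s → sum-cong-≋ λ r →
             *-distribʳ-sum (ι (galois s r j l)) λ i → ∂ (a i) s * ∂ (v i) r) ⟩
      ∑[ s < e ] ∑[ r < e ] ∑[ i < n ] (∂ (a i) s * ∂ (v i) r * ι (galois s r j l))
        ≈⟨ ∑-interchange₁₂ (λ i s r → ∂ (a i) s * ∂ (v i) r * ι (galois s r j l)) ⟨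
      ∑[ i < n ] ∑[ s < e ] ∑[ r < e ] (∂ (a i) s * ∂ (v i) r * ι (galois s r j l))
        ≈⟨ sum-cong-≋ (λ i → ∂-twisted (a i) (v i) j l) ⟨
      ∑[ i < n ] ∂ (a i * ∂ (v i) j) l
        ≈⟨ ∂-∑ (λ i → a i * ∂ (v i) j) l ⟨
      ∂ (∑[ i < n ] (a i * ∂ (v i) j)) l
        ≈⟨ ∂-cong (vanishes rel j) l ⟩
      ∂ 0# l
        ≈⟨ ∂-0 l ⟩
      0# ∎

  -- applying the counit: a relation among the ∂(vᵢ) is a relation among the vᵢ
  relation⇒combination : ∀ {n} {v : Fin n → Carrier} {a} →
                         IsRelation (∂ ∘ v) a → ∑[ i < n ] (a i * v i) ≈ 0#
  relation⇒combination {n} {v} {a} rel = begin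
    ∑[ i < n ] (a i * v i)
      ≈⟨ sum-cong-≋ (λ i → *-congˡ (∂-counit (v i))) ⟨
    ∑[ i < n ] (a i * ∑[ j < e ] (∂ (v i) j * ι (H.ε j)))
      ≈⟨ sum-cong-≋ (λ i → trans (*-distribˡ-sum (a i) λ j → ∂ (v i) j * ι (H.ε j))
                                 (sum-cong-≋ λ j → sym (*-assoc (a i) (∂ (v i) j) (ι (H.ε j))))) ⟩
    ∑[ i < n ] ∑[ j < e ] (a i * ∂ (v i) j * ι (H.ε j))
      ≈⟨ ∑-comm (λ i j → a i * ∂ (v i) j * ι (H.ε j)) ⟩
    ∑[ j < e ] ∑[ i < n ] (a i * ∂ (v i) j * ι (H.ε j))
      ≈⟨ sum-cong-≋ (λ j → *-distribʳ-sum (ι (H.ε j)) λ i → a i * ∂ (v i) j) ⟨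
    ∑[ j < e ] (∑[ i < n ] (a i * ∂ (v i) j) * ι (H.ε j))
      ≈⟨ ∑-zero (λ j → trans (*-congʳ (vanishes rel j)) (zeroˡ (ι (H.ε j)))) ⟩
    0# ∎

  independent-tail : ∀ {n} {v : Fin (suc n) → Carrier} →
                     LinearlyIndependentOverConstants v → LinearlyIndependentOverConstants (v ∘ suc)
  independent-tail {v = v} independent b constant combination i =
    independent (0# ∷ b) constant′ combination′ (suc i)
    where
    constant′ : ∀ i → IsConstant ((0# ∷ b) i)
    constant′ zero    j = trans (∂-0 j) (sym (zeroʳ _))
    constant′ (suc i)   = constant i
    combination′ : 0# * v zero + ∑ K (λ i → b i * v (suc i)) ≈ 0#
    combination′ = trans (+-cong (zeroˡ (v zero)) combination) (+-identityˡ 0#)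

  -- Induction on n; the head coefficient vanishes since otherwise
  -- normalising it to 1 yields a relation with constant coefficients.
  relations-vanish : ∀ {n} {v : Fin n → Carrier} → LinearlyIndependentOverConstants v →
                     ∀ a → IsRelation (∂ ∘ v) a → ∀ i → ¬ ¬ (a i ≈ 0#)
  relations-vanish {suc n} {v} independent a rel i = do
      a₀≈0 ← head-vanishes a rel
      vanishes-if-head-does a rel a₀≈0 i
    where
    vanishes-if-head-does : ∀ b → IsRelation (∂ ∘ v) b → b zero ≈ 0# → ∀ i → ¬ ¬ (b i ≈ 0#)
    vanishes-if-head-does b _   b₀≈0 zero    = return b₀≈0
    vanishes-if-head-does b rel b₀≈0 (suc i) =
      relations-vanish (independent-tail {v = v} independent) (b ∘ suc) (relation-tail rel b₀≈0) i

    -- with b₀ = 1, the defects ∂(b)ₛ − uₛ·b vanish, so b has constant coefficients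
    no-monic-relation : ∀ b → IsRelation (∂ ∘ v) b → b zero ≈ 1# → ¬ ¬ ⊥
    no-monic-relation b rel b₀≈1 = do
        constant ← ¬¬-all λ i → ¬¬-all λ s →
                     ¬¬-map (x∙y⁻¹≈ε⇒x≈y _ _)
                            (vanishes-if-head-does _ (defect-relation s) (defect-head s) i)
        return (1≉0 (trans (sym b₀≈1) (independent b constant (relation⇒combination rel) zero)))
      where
      defect-relation : ∀ s → IsRelation (∂ ∘ v) (λ i → ∂ (b i) s - ι (H.u s) * b i)
      defect-relation s = relation-sub (∂-relation rel s) (relation-scale rel (ι (H.u s)))
      defect-head : ∀ s → ∂ (b zero) s - ι (H.u s) * b zero ≈ 0#
      defect-head s = x≈y⇒x∙y⁻¹≈ε (begin
        ∂ (b zero) s        ≈⟨ ∂-cong b₀≈1 s ⟩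
        ∂ 1# s              ≈⟨ ∂-1 s ⟩
        ι (H.u s)           ≈⟨ *-identityʳ _ ⟨
        ι (H.u s) * 1#      ≈⟨ *-congˡ b₀≈1 ⟨
        ι (H.u s) * b zero  ∎)

    head-vanishes : ∀ b → IsRelation (∂ ∘ v) b → ¬ ¬ (b zero ≈ 0#)
    head-vanishes b rel b₀≉0 with inverse (b zero) b₀≉0
    ... | y , b₀y≈1 =
      no-monic-relation (λ i → y * b i) (relation-scale rel y) (trans (*-comm y (b zero)) b₀y≈1) id

-- If n > e, the n coaction vectors ∂(vᵢ) ∈ Kᵉ satisfy a nontrivial relation, which
-- must vanish by independence: contradiction.
theorem4p4 : ∀ {c ℓ c' ℓ' : Level} (k : Field c ℓ) (e : ℕ)
               (H : FiniteHopfAlgebra k e) (K : GField k H c' ℓ') →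
               GField.DegreeOverConstants≤ K e
theorem4p4 k e H K n v independent = decidable-stable (n ≤? e) λ n≰e →
  more-vectors-than-coordinates (≰⇒> n≰e) (∂ ∘ v) λ (a , rel , i , aᵢ≉0) →
    relations-vanish independent a rel i aᵢ≉0
  where
  open GField K using (∂)
  open LinearDependence (GField.K K) using (more-vectors-than-coordinates)
  open GFieldRelations K using (relations-vanish)
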